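{- Let $v$ be a vertex of a graph $G$ of genus $g\ge2$, and let $G'$ be the graph obtained from $G$ by deleting $v$ and all edges incident to $v$. If $G'$ is a tree, then $v$ is not a Weierstrass point of $G$.
   Context: A graph is a finite connected multigraph without loop edges; its genus is $g=|E(G)|-|V(G)|+1$. $\mathrm{Div}(G)$ is the free abelian group on $V(G)$; for $\varphi:V(G)\to\mathbb Z$, $\Delta(\varphi)=\sum_w\sum_{e=wu\in E(G)}(\varphi(w)-\varphi(u))(w)$; $D\sim D'$ iff $D-D'=\Delta(\varphi)$ for some $\varphi$; $|D|=\{E\ge0:E\sim D\}$; $r(D)=-1$ if $|D|=\emptyset$, otherwise the maximal $k$ with $|D-E|\ne\emptyset$ for every effective $E$ of degree $k$. A vertex $P$ of $G$ is a Weierstrass point if $r(g(P))\ge1$. -}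

module Defs where

open import Data.Nat as ℕ using (ℕ)
open import Data.Fin using (Fin; _≟_)
open import Data.Integer as ℤ using (ℤ; 0ℤ; +_; _-_; _≤_)
open import Data.List using (List; []; _∷_; length; map; foldr; lookup; filter; allFin)
open import Data.List.Membership.Propositional using (_∈_)
open import Data.List.Relation.Unary.All using (All)
open import Data.List.Relation.Unary.Unique.Propositional using (Unique)
open import Data.Product using (Σ; ∃; _×_; _,_; proj₁; proj₂)
open import Data.Sum using (_⊎_)
open import Data.Bool using (Bool; true; false; if_then_else_; _∨_; not)
open import Relation.Nullary using (¬_; ⌊_⌋)
open import Relation.Binary.PropositionalEquality using (_≡_; _≢_)

-- Edge lists: a multigraph on vertex set Fin n is a list of (unordered) edges,
-- each recorded as a pair of endpoints; repeated entries are parallel edges.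
EdgeList : ℕ → Set
EdgeList n = List (Fin n × Fin n)

Adjacent : ∀ {n} → EdgeList n → Fin n → Fin n → Set
Adjacent E u w = ((u , w) ∈ E) ⊎ ((w , u) ∈ E)

data Reachable {n} (E : EdgeList n) : Fin n → Fin n → Set where
  here : ∀ {u} → Reachable E u u
  step : ∀ {u w x} → Adjacent E u w → Reachable E w x → Reachable E u x

record Graph : Set where
  field
    n         : ℕ
    edges     : EdgeList n
    noLoops   : All (λ e → proj₁ e ≢ proj₂ e) edges
    connected : ∀ u w → Reachable edges u w

open Graph public

genus : Graph → ℤ
genus G = (+ length (edges G) - + n G) ℤ.+ + 1

Div : ℕ → Set
Div n = Fin n → ℤ

sumℤ : List ℤ → ℤ
sumℤ = foldr ℤ._+_ 0ℤ

deg : ∀ {n} → Div n → ℤ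
deg {n} D = sumℤ (map D (allFin n))

Effective : ∀ {n} → Div n → Set
Effective D = ∀ v → 0ℤ ≤ D v

_-D_ : ∀ {n} → Div n → Div n → Div n
(D -D D') v = D v - D' v

eqᵇ : ∀ {n} → Fin n → Fin n → Bool
eqᵇ a b = ⌊ a ≟ b ⌋

edgeContrib : ∀ {n} → (Fin n → ℤ) → Fin n → Fin n × Fin n → ℤ
edgeContrib φ w (a , b) =
  if eqᵇ a w then φ a - φ b else (if eqᵇ b w then φ b - φ a else 0ℤ)

Δ : (G : Graph) → (Fin (n G) → ℤ) → Div (n G)
Δ G φ w = sumℤ (map (edgeContrib φ w) (edges G))

LinEquiv : (G : Graph) → Div (n G) → Div (n G) → Set
LinEquiv G D D' = Σ (Fin (n G) → ℤ) λ φ → ∀ w → D w - D' w ≡ Δ G φ w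

LinSysNonempty : (G : Graph) → Div (n G) → Set
LinSysNonempty G D = Σ (Div (n G)) λ E → Effective E × LinEquiv G E D

RankProperty : (G : Graph) → Div (n G) → ℕ → Set
RankProperty G D k =
  (E : Div (n G)) → Effective E → deg E ≡ + k → LinSysNonempty G (D -D E)

-- r(D) ≥ 1 : |D| ≠ ∅ and the maximal k with RankProperty is ≥ 1,
-- i.e. RankProperty holds for some k ≥ 1
RankAtLeastOne : (G : Graph) → Div (n G) → Set
RankAtLeastOne G D =
  LinSysNonempty G D × Σ ℕ λ k → (1 ℕ.≤ k) × RankProperty G D k

gP : (G : Graph) → Fin (n G) → Div (n G)
gP G P w = if eqᵇ w P then genus G else 0ℤ

WeierstrassPoint : (G : Graph) → Fin (n G) → Set
WeierstrassPoint G P = RankAtLeastOne G (gP G P)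

-- Deleting a vertex v: the edges not incident to v (vertex set Fin n ∖ {v})
incident : ∀ {n} → Fin n → Fin n × Fin n → Bool
incident v (a , b) = eqᵇ a v ∨ eqᵇ b v

deleteVertexEdges : ∀ {n} → Fin n → EdgeList n → EdgeList n
deleteVertexEdges v [] = []
deleteVertexEdges v (e ∷ E) =
  if incident v e then deleteVertexEdges v E else e ∷ deleteVertexEdges v E

-- trails: walks using edges (identified by their index in the edge list)
data Trail {n} (E : EdgeList n) : Fin n → Fin n → List (Fin (length E)) → Set where
  nil  : ∀ {u} → Trail E u u []
  cons : ∀ {u w x is} (i : Fin (length E)) →
         (lookup E i ≡ (u , w)) ⊎ (lookup E i ≡ (w , u)) →
         Trail E w x is → Trail E u x (i ∷ is)

HasCycle : ∀ {n} → EdgeList n → Set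
HasCycle {n} E = Σ (Fin n) λ u → Σ (List (Fin (length E))) λ is →
  Trail E u u is × (is ≢ []) × Unique is

DeletionIsTree : (G : Graph) → Fin (n G) → Set
DeletionIsTree G v =
  (∀ a b → a ≢ v → b ≢ v → Reachable (deleteVertexEdges v (edges G)) a b)
  × ¬ HasCycle (deleteVertexEdges v (edges G))

-- Suppose r(g(v)) ≥ 1 and pick w ≠ v. Then |g(v) − k(w)| ≠ ∅ for some k ≥ 1, which yields
-- a potential φ with Δφ ≥ k(w) − g(v). Off v the function φ is superharmonic, and strictly so
-- at w; since G − v is connected, a minimum of φ at any vertex other than v would spread along
-- G − v to w, where Δφ ≤ 0 at a minimum. So v is the unique minimum, and then
-- −g ≤ Δφ(v) ≤ −val(v), i.e. |E(G − v)| = |E| − val(v) ≥ |E| − g = |V| − 1. But G − v is a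
-- forest on |V| vertices with the isolated vertex v, so it has at most |V| − 2 edges.
module Submission where

open import Defs
open import Data.Fin using (Fin)
open import Data.Integer using (+_; _≤_)
open import Relation.Nullary using (¬_)

open import Function using (_∘_)
open import Data.Nat as ℕ using (ℕ; z≤n; s≤s)
import Data.Nat.Properties as ℕP
open import Data.Fin using (zero; suc; _≟_)
open import Data.Fin.Properties using (suc-injective)
open import Data.Integer as ℤ using (ℤ; 0ℤ; 1ℤ; -1ℤ; _-_; _<_; +≤+; +<+)
import Data.Integer.Properties as ℤP
open import Data.Integer.Tactic.RingSolver using (solve-∀)
open import Data.Bool using (Bool; true; false; if_then_else_; _∨_)
open import Data.Bool.Properties using (∨-zeroʳ; ∨-conicalˡ; ∨-conicalʳ)
open import Data.List using (List; []; _∷_; length; map; lookup; allFin; tabulate; _++_)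
open import Data.List.Properties using (map-tabulate)
open import Data.List.Membership.Propositional using (_∈_; _∉_)
open import Data.List.Membership.Propositional.Properties using (∈-map⁻; ∈-lookup; ∈-allFin)
open import Data.List.Relation.Unary.Any using (here; there)
open import Data.List.Relation.Unary.All as All using (_∷_)
open import Data.List.Relation.Unary.All.Properties using (¬Any⇒All¬)
open import Data.List.Relation.Unary.Unique.Propositional using (Unique; []; _∷_)
import Data.List.Relation.Unary.Unique.Propositional.Properties as Unique
open import Data.List.Relation.Binary.Disjoint.Propositional using (Disjoint)
import Data.List.Extrema ℤP.≤-totalOrder as Extrema
open import Algebra.Properties.CommutativeSemigroup ℤP.+-commutativeSemigroup using (interchange)
open import Data.Product using (∃; ∃-syntax; _×_; _,_; proj₁; proj₂; map₁)
open import Data.Sum using (_⊎_; inj₁; inj₂)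
open import Relation.Nullary using (yes; no)
open import Relation.Nullary.Decidable using (isYes≗does; dec-true; dec-false)
open import Relation.Nullary.Negation using (contradiction)
open import Relation.Binary.PropositionalEquality

eqᵇ-≡ : ∀ {n} {a b : Fin n} → a ≡ b → eqᵇ a b ≡ true
eqᵇ-≡ {a = a} {b} a≡b = trans (isYes≗does (a ≟ b)) (dec-true (a ≟ b) a≡b)

eqᵇ-refl : ∀ {n} (a : Fin n) → eqᵇ a a ≡ true
eqᵇ-refl a = eqᵇ-≡ refl

eqᵇ-≢ : ∀ {n} {a b : Fin n} → a ≢ b → eqᵇ a b ≡ false
eqᵇ-≢ {a = a} {b} a≢b = trans (isYes≗does (a ≟ b)) (dec-false (a ≟ b) a≢b)

eqᵇ-false⇒≢ : ∀ {n} {a b : Fin n} → eqᵇ a b ≡ false → a ≢ b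
eqᵇ-false⇒≢ a≠b a≡b with () ← trans (sym (eqᵇ-≡ a≡b)) a≠b

-- Forests

count : ∀ {n} → (Fin n → Bool) → ℕ
count {ℕ.zero}  p = 0
count {ℕ.suc n} p = (if p zero then 1 else 0) ℕ.+ count (p ∘ suc)

count-all : ∀ {n} {p : Fin n → Bool} → (∀ x → p x ≡ true) → count p ≡ n
count-all {ℕ.zero}  all = refl
count-all {ℕ.suc n} all rewrite all zero = cong ℕ.suc (count-all (all ∘ suc))

count-cong : ∀ {n} {p q : Fin n → Bool} → (∀ x → p x ≡ q x) → count p ≡ count q
count-cong {ℕ.zero}  p≗q = refl
count-cong {ℕ.suc n} p≗q rewrite p≗q zero = cong (_ ℕ.+_) (count-cong (p≗q ∘ suc))

count-remove : ∀ {n} {p q : Fin n → Bool} (c : Fin n) → p c ≡ true → q c ≡ false →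
  (∀ x → x ≢ c → p x ≡ q x) → count p ≡ ℕ.suc (count q)
count-remove {ℕ.suc n} zero pc qc p≗q rewrite pc | qc =
  cong ℕ.suc (count-cong (λ x → p≗q (suc x) λ ()))
count-remove {ℕ.suc n} {q = q} (suc c) pc qc p≗q rewrite p≗q zero (λ ()) =
  trans (cong (_ ℕ.+_) (count-remove c pc qc (λ x x≢c → p≗q (suc x) (x≢c ∘ suc-injective))))
        (ℕP.+-suc _ (count (q ∘ suc)))

1≤count : ∀ {n} (p : Fin n → Bool) {x} → p x ≡ true → 1 ℕ.≤ count p
1≤count p {zero}  px rewrite px = s≤s z≤n
1≤count p {suc x} px = ℕP.≤-trans (1≤count (p ∘ suc) px) (ℕP.m≤n+m _ _)

2≤count : ∀ {n} (p : Fin n → Bool) {x y} → p x ≡ true → p y ≡ true → x ≢ y → 2 ℕ.≤ count p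
2≤count p {zero}  {zero}  _  _  x≢y = contradiction refl x≢y
2≤count p {zero}  {suc y} px py _   rewrite px = s≤s (1≤count (p ∘ suc) py)
2≤count p {suc x} {zero}  px py _   rewrite py = s≤s (1≤count (p ∘ suc) px)
2≤count p {suc x} {suc y} px py x≢y =
  ℕP.≤-trans (2≤count (p ∘ suc) px py (x≢y ∘ cong suc)) (ℕP.m≤n+m _ _)

UniqueTrail : ∀ {n} → EdgeList n → Fin n → Fin n → Set
UniqueTrail E x y = ∃ λ is → Trail E x y is × Unique is

Trail-weaken : ∀ {n} {E : EdgeList n} {e x y is} → Trail E x y is → Trail (e ∷ E) x y (map suc is)
Trail-weaken nil          = nil
Trail-weaken (cons i p t) = cons (suc i) p (Trail-weaken t)

Trail-++ : ∀ {n} {E : EdgeList n} {x y z is js} →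
  Trail E x y is → Trail E y z js → Trail E x z (is ++ js)
Trail-++ nil          t′ = t′
Trail-++ (cons i p t) t′ = cons i p (Trail-++ t t′)

UniqueTrail-weaken : ∀ {n} {E : EdgeList n} {e x y} → UniqueTrail E x y → UniqueTrail (e ∷ E) x y
UniqueTrail-weaken (is , t , u) = map suc is , Trail-weaken t , Unique.map⁺ suc-injective u

zero∉map-suc : ∀ {m} (is : List (Fin m)) → zero ∉ map suc is
zero∉map-suc is 0∈ with ∈-map⁻ suc 0∈
... | _ , _ , ()

Unique-zero∷map-suc : ∀ {m} {is : List (Fin m)} → Unique is → Unique (zero ∷ map suc is)
Unique-zero∷map-suc {is = is} u = ¬Any⇒All¬ _ (zero∉map-suc is) ∷ Unique.map⁺ suc-injective u

Disjoint-map-suc : ∀ {m} {is js : List (Fin m)} →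
  Disjoint is js → Disjoint (map suc is) (zero ∷ map suc js)
Disjoint-map-suc {is = is} _ (0∈ , here refl) = zero∉map-suc is 0∈
Disjoint-map-suc {js = js} d (i∈ , there j∈) with ∈-map⁻ suc i∈ | ∈-map⁻ suc j∈
... | i , i∈is , refl | j , j∈js , si≡sj = d (i∈is , subst (_∈ js) (sym (suc-injective si≡sj)) j∈js)

HasCycle-weaken : ∀ {n} {E : EdgeList n} {e} → HasCycle E → HasCycle (e ∷ E)
HasCycle-weaken (u , []     , _ , []≢[] , _) = contradiction refl []≢[]
HasCycle-weaken (u , i ∷ is , t , _     , uq) =
  u , map suc (i ∷ is) , Trail-weaken t , (λ ()) , Unique.map⁺ suc-injective uq

closing-edge⇒cycle : ∀ {n} {E : EdgeList n} {a b} → UniqueTrail E b a → HasCycle ((a , b) ∷ E)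
closing-edge⇒cycle {a = a} (is , t , u) =
  a , zero ∷ map suc is , cons zero (inj₁ refl) (Trail-weaken t) , (λ ()) , Unique-zero∷map-suc u

EdgeConstant : ∀ {n} → (Fin n → Fin n) → EdgeList n → Set
EdgeConstant ℓ E = ∀ i → ℓ (proj₁ (lookup E i)) ≡ ℓ (proj₂ (lookup E i))

module _ {n} {E : EdgeList n} {ℓ : Fin n → Fin n} (ℓ-edge : EdgeConstant ℓ E) where

  label-step : ∀ {u w} i → (lookup E i ≡ (u , w)) ⊎ (lookup E i ≡ (w , u)) → ℓ u ≡ ℓ w
  label-step i (inj₁ refl) = ℓ-edge i
  label-step i (inj₂ refl) = sym (ℓ-edge i)

  label-trail-edge : ∀ {x y is i} → Trail E x y is → i ∈ is → ℓ (proj₁ (lookup E i)) ≡ ℓ x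
  label-trail-edge (cons i (inj₁ refl) t) (here refl) = refl
  label-trail-edge (cons i (inj₂ refl) t) (here refl) = ℓ-edge i
  label-trail-edge (cons i p t)           (there i∈)  =
    trans (label-trail-edge t i∈) (sym (label-step i p))

  trails-disjoint : ∀ {x y x′ y′ is js} → Trail E x y is → Trail E x′ y′ js → ℓ x ≢ ℓ x′ →
    Disjoint is js
  trails-disjoint t t′ ℓx≢ℓx′ (i∈is , i∈js) =
    ℓx≢ℓx′ (trans (sym (label-trail-edge t i∈is)) (label-trail-edge t′ i∈js))

  bridge : ∀ {e x p q y} → UniqueTrail E x p → (e ≡ (p , q)) ⊎ (e ≡ (q , p)) →
    UniqueTrail E q y → ℓ x ≢ ℓ q → UniqueTrail (e ∷ E) x y
  bridge (is , t , u) pq (js , t′ , u′) ℓx≢ℓq =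
    map suc is ++ zero ∷ map suc js ,
    Trail-++ (Trail-weaken t) (cons zero pq (Trail-weaken t′)) ,
    Unique.++⁺ (Unique.map⁺ suc-injective u) (Unique-zero∷map-suc u′)
               (Disjoint-map-suc (trails-disjoint t t′ ℓx≢ℓq))

isRoot : ∀ {n} → (Fin n → Fin n) → Fin n → Bool
isRoot ℓ x = eqᵇ (ℓ x) x

-- Union–find invariant: the roots of `label` represent the components, and each edge of a
-- forest merges two of them.
record ComponentLabelling {n} (E : EdgeList n) : Set where
  field
    label         : Fin n → Fin n
    label-idem    : ∀ x → label (label x) ≡ label x
    label-edge    : EdgeConstant label E
    trail         : ∀ {x y} → label x ≡ label y → UniqueTrail E x y
    edges+roots≡n : length E ℕ.+ count (isRoot label) ≡ n

open ComponentLabelling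

discrete : ∀ {n} → ComponentLabelling {n} []
discrete = record
  { label         = λ x → x
  ; label-idem    = λ _ → refl
  ; label-edge    = λ ()
  ; trail         = λ { refl → [] , nil , [] }
  ; edges+roots≡n = count-all eqᵇ-refl
  }

module Merge {n} (ℓ : Fin n → Fin n) (ℓ-idem : ∀ x → ℓ (ℓ x) ≡ ℓ x)
             (a b : Fin n) (ℓa≢ℓb : ℓ a ≢ ℓ b) where

  redirect : Fin n → Fin n
  redirect r = if eqᵇ r (ℓ b) then ℓ a else r

  merged : Fin n → Fin n
  merged = redirect ∘ ℓ

  redirect-cases : ∀ r → (r ≡ ℓ b × redirect r ≡ ℓ a) ⊎ (r ≢ ℓ b × redirect r ≡ r)
  redirect-cases r with r ≟ ℓ b
  ... | yes r≡ℓb = inj₁ (r≡ℓb , refl)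
  ... | no  r≢ℓb = inj₂ (r≢ℓb , refl)

  redirect-ℓa : redirect (ℓ a) ≡ ℓ a
  redirect-ℓa rewrite eqᵇ-≢ ℓa≢ℓb = refl

  redirect-ℓb : redirect (ℓ b) ≡ ℓ a
  redirect-ℓb rewrite eqᵇ-refl (ℓ b) = refl

  merged-idem : ∀ x → merged (merged x) ≡ merged x
  merged-idem x with redirect-cases (ℓ x)
  ... | inj₁ (_ , ≡ℓa) = begin
    redirect (ℓ (redirect (ℓ x))) ≡⟨ cong (redirect ∘ ℓ) ≡ℓa ⟩
    redirect (ℓ (ℓ a))            ≡⟨ cong redirect (ℓ-idem a) ⟩
    redirect (ℓ a)                ≡⟨ redirect-ℓa ⟩
    ℓ a                           ≡⟨ sym ≡ℓa ⟩
    redirect (ℓ x)                ∎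
    where open ≡-Reasoning
  ... | inj₂ (_ , ≡ℓx) = trans (cong (redirect ∘ ℓ) ≡ℓx) (cong redirect (ℓ-idem x))

  merged-≡ : ∀ {x y} → merged x ≡ merged y →
    ℓ x ≡ ℓ y ⊎ (ℓ x ≡ ℓ b × ℓ a ≡ ℓ y) ⊎ (ℓ x ≡ ℓ a × ℓ b ≡ ℓ y)
  merged-≡ {x} {y} eq with redirect-cases (ℓ x) | redirect-cases (ℓ y)
  ... | inj₁ (x≡ℓb , _)    | inj₁ (y≡ℓb , _)    = inj₁ (trans x≡ℓb (sym y≡ℓb))
  ... | inj₂ (_ , mx≡ℓx)   | inj₂ (_ , my≡ℓy)   = inj₁ (trans (sym mx≡ℓx) (trans eq my≡ℓy))
  ... | inj₁ (x≡ℓb , mx≡ℓa) | inj₂ (_ , my≡ℓy)  =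
    inj₂ (inj₁ (x≡ℓb , trans (sym mx≡ℓa) (trans eq my≡ℓy)))
  ... | inj₂ (_ , mx≡ℓx)   | inj₁ (y≡ℓb , my≡ℓa) =
    inj₂ (inj₂ (trans (sym mx≡ℓx) (trans eq my≡ℓa) , sym y≡ℓb))

  merged-roots : count (isRoot ℓ) ≡ ℕ.suc (count (isRoot merged))
  merged-roots =
    count-remove (ℓ b) (eqᵇ-≡ (ℓ-idem b)) (eqᵇ-≢ (ℓa≢ℓb ∘ trans (sym merged-ℓb))) same-off-ℓb
    where
    merged-ℓb : merged (ℓ b) ≡ ℓ a
    merged-ℓb = trans (cong redirect (ℓ-idem b)) redirect-ℓb

    same-off-ℓb : ∀ x → x ≢ ℓ b → isRoot ℓ x ≡ isRoot merged x
    same-off-ℓb x x≢ℓb with redirect-cases (ℓ x)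
    ... | inj₁ (ℓx≡ℓb , mx≡ℓa) =
      trans (eqᵇ-≢ (λ ℓx≡x → x≢ℓb (trans (sym ℓx≡x) ℓx≡ℓb)))
            (sym (eqᵇ-≢ (λ mx≡x → ℓa≢ℓb (trans (sym (ℓ-idem a))
              (trans (cong ℓ (trans (sym mx≡ℓa) mx≡x)) ℓx≡ℓb)))))
    ... | inj₂ (_ , mx≡ℓx) = cong (λ r → eqᵇ r x) (sym mx≡ℓx)

add-bridge : ∀ {n} {a b : Fin n} {E} (L : ComponentLabelling E) → label L a ≢ label L b →
  ComponentLabelling ((a , b) ∷ E)
add-bridge {n} {a} {b} {E} L ℓa≢ℓb = record
  { label         = merged
  ; label-idem    = merged-idem
  ; label-edge    = λ { zero → trans redirect-ℓa (sym redirect-ℓb)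
                      ; (suc i) → cong redirect (label-edge L i) }
  ; trail         = trail′
  ; edges+roots≡n = begin
      ℕ.suc (length E) ℕ.+ count (isRoot merged) ≡⟨ sym (ℕP.+-suc _ _) ⟩
      length E ℕ.+ ℕ.suc (count (isRoot merged)) ≡⟨ cong (length E ℕ.+_) (sym merged-roots) ⟩
      length E ℕ.+ count (isRoot (label L))      ≡⟨ edges+roots≡n L ⟩
      n                                          ∎
  }
  where
  open Merge (label L) (label-idem L) a b ℓa≢ℓb
  open ≡-Reasoning

  trail′ : ∀ {x y} → merged x ≡ merged y → UniqueTrail ((a , b) ∷ E) x y
  trail′ eq with merged-≡ eq
  ... | inj₁ ℓx≡ℓy = UniqueTrail-weaken (trail L ℓx≡ℓy)
  ... | inj₂ (inj₁ (ℓx≡ℓb , ℓa≡ℓy)) = bridge (label-edge L) (trail L ℓx≡ℓb) (inj₂ refl)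
    (trail L ℓa≡ℓy) (λ ℓx≡ℓa → ℓa≢ℓb (trans (sym ℓx≡ℓa) ℓx≡ℓb))
  ... | inj₂ (inj₂ (ℓx≡ℓa , ℓb≡ℓy)) = bridge (label-edge L) (trail L ℓx≡ℓa) (inj₁ refl)
    (trail L ℓb≡ℓy) (λ ℓx≡ℓb → ℓa≢ℓb (trans (sym ℓx≡ℓa) ℓx≡ℓb))

acyclic⇒labelling : ∀ {n} (E : EdgeList n) → ¬ HasCycle E → ComponentLabelling E
acyclic⇒labelling []            _       = discrete
acyclic⇒labelling ((a , b) ∷ E) acyclic =
  extend (acyclic⇒labelling E (acyclic ∘ HasCycle-weaken))
  where
  extend : ComponentLabelling E → ComponentLabelling ((a , b) ∷ E)
  extend L with label L a ≟ label L b
  ... | yes ℓa≡ℓb = contradiction (closing-edge⇒cycle (trail L (sym ℓa≡ℓb))) acyclic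
  ... | no  ℓa≢ℓb = add-bridge L ℓa≢ℓb

separated⇒2+|E|≤n : ∀ {n} {E : EdgeList n} (L : ComponentLabelling E) {x y} →
  label L x ≢ label L y → 2 ℕ.+ length E ℕ.≤ n
separated⇒2+|E|≤n {n} {E} L {x} {y} ℓx≢ℓy = begin
  2 ℕ.+ length E                        ≡⟨ ℕP.+-comm 2 (length E) ⟩
  length E ℕ.+ 2                        ≤⟨ ℕP.+-monoʳ-≤ (length E) two-roots ⟩
  length E ℕ.+ count (isRoot (label L)) ≡⟨ edges+roots≡n L ⟩
  n                                     ∎
  where
  open ℕP.≤-Reasoning
  two-roots : 2 ℕ.≤ count (isRoot (label L))
  two-roots = 2≤count (isRoot (label L)) (eqᵇ-≡ (label-idem L x)) (eqᵇ-≡ (label-idem L y)) ℓx≢ℓy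

-- Vertex deletion

not-incident : ∀ {n} {v a b : Fin n} → incident v (a , b) ≡ false → a ≢ v × b ≢ v
not-incident inc = eqᵇ-false⇒≢ (∨-conicalˡ _ _ inc) , eqᵇ-false⇒≢ (∨-conicalʳ _ _ inc)

∈-deleteVertexEdges⁻ : ∀ {n} {v : Fin n} (E : EdgeList n) {a b} →
  (a , b) ∈ deleteVertexEdges v E → (a , b) ∈ E × a ≢ v × b ≢ v
∈-deleteVertexEdges⁻ {v = v} (e ∷ E) ab∈ with incident v e in inc
... | true = map₁ there (∈-deleteVertexEdges⁻ E ab∈)
... | false with ab∈
...   | here refl = here refl , not-incident inc
...   | there ab∈′ = map₁ there (∈-deleteVertexEdges⁻ E ab∈′)

deletion-adjacent : ∀ {n} {v x y : Fin n} (E : EdgeList n) →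
  Adjacent (deleteVertexEdges v E) x y → Adjacent E x y × y ≢ v
deletion-adjacent E (inj₁ xy∈) with ∈-deleteVertexEdges⁻ E xy∈
... | xy∈E , _ , y≢v = inj₁ xy∈E , y≢v
deletion-adjacent E (inj₂ yx∈) with ∈-deleteVertexEdges⁻ E yx∈
... | yx∈E , y≢v , _ = inj₂ yx∈E , y≢v

lookup-deleteVertexEdges : ∀ {n} {v a b : Fin n} (E : EdgeList n) i →
  lookup (deleteVertexEdges v E) i ≡ (a , b) → a ≢ v × b ≢ v
lookup-deleteVertexEdges E i ≡ab =
  proj₂ (∈-deleteVertexEdges⁻ E (subst (_∈ _) ≡ab (∈-lookup {xs = deleteVertexEdges _ E} i)))

trail-from-deleted : ∀ {n} {v y : Fin n} (E : EdgeList n) {is} →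
  Trail (deleteVertexEdges v E) v y is → y ≡ v
trail-from-deleted E nil = refl
trail-from-deleted E (cons i (inj₁ ≡vw) _) =
  contradiction refl (proj₁ (lookup-deleteVertexEdges E i ≡vw))
trail-from-deleted E (cons i (inj₂ ≡wv) _) =
  contradiction refl (proj₂ (lookup-deleteVertexEdges E i ≡wv))

acyclic-deletion⇒2+|E|≤n : ∀ {n} {v w : Fin n} (E : EdgeList n) → w ≢ v →
  ¬ HasCycle (deleteVertexEdges v E) → 2 ℕ.+ length (deleteVertexEdges v E) ℕ.≤ n
acyclic-deletion⇒2+|E|≤n E w≢v acyclic = separated⇒2+|E|≤n L λ ℓv≡ℓw →
  w≢v (trail-from-deleted E (proj₁ (proj₂ (trail L ℓv≡ℓw))))
  where L = acyclic⇒labelling _ acyclic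

-- Minima of potentials

data EdgeAt {n} (x : Fin n) : Fin n × Fin n → Set where
  from : ∀ y → EdgeAt x (x , y)
  to   : ∀ y → EdgeAt x (y , x)
  away : ∀ {a b} → a ≢ x → b ≢ x → EdgeAt x (a , b)

edgeAt : ∀ {n} (x : Fin n) e → EdgeAt x e
edgeAt x (a , b) with a ≟ x | b ≟ x
... | yes refl | _        = from b
... | no _     | yes refl = to a
... | no a≢x   | no b≢x   = away a≢x b≢x

module _ {n} (φ : Fin n → ℤ) (x : Fin n) where

  edgeContrib-from : ∀ y → edgeContrib φ x (x , y) ≡ φ x - φ y
  edgeContrib-from y rewrite eqᵇ-refl x = refl

  edgeContrib-to : ∀ y → edgeContrib φ x (y , x) ≡ φ x - φ y
  edgeContrib-to y with y ≟ x
  ... | yes refl = refl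
  ... | no _ rewrite eqᵇ-refl x = refl

  edgeContrib-away : ∀ {a b} → a ≢ x → b ≢ x → edgeContrib φ x (a , b) ≡ 0ℤ
  edgeContrib-away a≢x b≢x rewrite eqᵇ-≢ a≢x | eqᵇ-≢ b≢x = refl

incident-from : ∀ {n} (x y : Fin n) → incident x (x , y) ≡ true
incident-from x y rewrite eqᵇ-refl x = refl

incident-to : ∀ {n} (x y : Fin n) → incident x (y , x) ≡ true
incident-to x y rewrite eqᵇ-refl x = ∨-zeroʳ (eqᵇ y x)

incident-away : ∀ {n} {x a b : Fin n} → a ≢ x → b ≢ x → incident x (a , b) ≡ false
incident-away a≢x b≢x rewrite eqᵇ-≢ a≢x | eqᵇ-≢ b≢x = refl

module _ {A : Set} {f : A → ℤ} (f≤0 : ∀ a → f a ≤ 0ℤ) where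

  sum-nonpos : ∀ xs → sumℤ (map f xs) ≤ 0ℤ
  sum-nonpos []       = ℤP.≤-refl
  sum-nonpos (a ∷ xs) = ℤP.+-mono-≤ (f≤0 a) (sum-nonpos xs)

  sum≤term : ∀ {xs a} → a ∈ xs → sumℤ (map f xs) ≤ f a
  sum≤term {a ∷ xs} (here refl) =
    ℤP.≤-trans (ℤP.+-monoʳ-≤ (f a) (sum-nonpos xs)) (ℤP.≤-reflexive (ℤP.+-identityʳ (f a)))
  sum≤term {b ∷ xs} {a} (there a∈) =
    ℤP.≤-trans (ℤP.+-mono-≤ (f≤0 b) (sum≤term a∈)) (ℤP.≤-reflexive (ℤP.+-identityˡ (f a)))

IsMinimum : ∀ {n} → (Fin n → ℤ) → Fin n → Set
IsMinimum φ x = ∀ y → φ x ≤ φ y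

minimum : ∀ {n} (φ : Fin n → ℤ) → Fin n → ∃ (IsMinimum φ)
minimum {n} φ x₀ = Extrema.argmin φ x₀ (allFin n) ,
  λ y → All.lookup (Extrema.f[argmin]≤f[xs] x₀ (allFin n)) (∈-allFin y)

edgeContrib-nonpos-at-min : ∀ {n} {φ : Fin n → ℤ} {x} → IsMinimum φ x → ∀ e → edgeContrib φ x e ≤ 0ℤ
edgeContrib-nonpos-at-min {φ = φ} {x} min e with edgeAt x e
... | from y = ℤP.≤-trans (ℤP.≤-reflexive (edgeContrib-from φ x y)) (ℤP.i≤j⇒i-j≤0 (min y))
... | to y   = ℤP.≤-trans (ℤP.≤-reflexive (edgeContrib-to φ x y)) (ℤP.i≤j⇒i-j≤0 (min y))
... | away a≢x b≢x = ℤP.≤-reflexive (edgeContrib-away φ x a≢x b≢x)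

Δ-nonpos-at-min : (G : Graph) {φ : Fin (n G) → ℤ} {x : Fin (n G)} → IsMinimum φ x → Δ G φ x ≤ 0ℤ
Δ-nonpos-at-min G min = sum-nonpos (edgeContrib-nonpos-at-min min) (edges G)

minimum-spreads : (G : Graph) {φ : Fin (n G) → ℤ} {x y : Fin (n G)} → IsMinimum φ x →
  0ℤ ≤ Δ G φ x → Adjacent (edges G) x y → IsMinimum φ y
minimum-spreads G {φ} {x} {y} min 0≤Δ adj z =
  ℤP.≤-trans (ℤP.0≤i-j⇒j≤i (ℤP.≤-trans 0≤Δ (Δ≤ adj))) (min z)
  where
  Δ≤ : Adjacent (edges G) x y → Δ G φ x ≤ φ x - φ y
  Δ≤ (inj₁ xy∈) = subst (Δ G φ x ≤_) (edgeContrib-from φ x y)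
                    (sum≤term (edgeContrib-nonpos-at-min min) xy∈)
  Δ≤ (inj₂ yx∈) = subst (Δ G φ x ≤_) (edgeContrib-to φ x y)
                    (sum≤term (edgeContrib-nonpos-at-min min) yx∈)

minimum-spreads-in-deletion : (G : Graph) (v : Fin (n G)) {φ : Fin (n G) → ℤ} →
  (∀ x → x ≢ v → 0ℤ ≤ Δ G φ x) → ∀ {x y} → Reachable (deleteVertexEdges v (edges G)) x y →
  x ≢ v → IsMinimum φ x → IsMinimum φ y
minimum-spreads-in-deletion G v 0≤Δ here _ min = min
minimum-spreads-in-deletion G v 0≤Δ (step adj r) x≢v min with deletion-adjacent (edges G) adj
... | adj′ , y≢v =
  minimum-spreads-in-deletion G v 0≤Δ r y≢v (minimum-spreads G min (0≤Δ _ x≢v) adj′)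

minimum-only-at-deleted-vertex : (G : Graph) (v w : Fin (n G)) (φ : Fin (n G) → ℤ) →
  (∀ x → x ≢ v → Reachable (deleteVertexEdges v (edges G)) x w) →
  (∀ x → x ≢ v → 0ℤ ≤ Δ G φ x) → 0ℤ < Δ G φ w →
  ∀ x → x ≢ v → ¬ IsMinimum φ x
minimum-only-at-deleted-vertex G v w φ reach 0≤Δ 0<Δw x x≢v min =
  ℤP.<-irrefl refl (ℤP.<-≤-trans 0<Δw (Δ-nonpos-at-min G min-w))
  where min-w = minimum-spreads-in-deletion G v 0≤Δ (reach x x≢v) x≢v min

unique-minimum⇒strict : ∀ {n} (φ : Fin n → ℤ) v → (∀ x → x ≢ v → ¬ IsMinimum φ x) →
  ∀ x → x ≢ v → φ v < φ x
unique-minimum⇒strict φ v no-min x x≢v with minimum φ v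
... | m , m-min with m ≟ v
...   | no  m≢v  = contradiction m-min (no-min m m≢v)
...   | yes refl = ℤP.≰⇒> λ φx≤φv → no-min x x≢v (λ y → ℤP.≤-trans φx≤φv (m-min y))

i<j⇒i-j≤-1 : ∀ {i j} → i < j → i - j ≤ -1ℤ
i<j⇒i-j≤-1 {i} {j} i<j = subst (_≤ -1ℤ) (shift i j)
  (ℤP.+-monoˡ-≤ -1ℤ (ℤP.i≤j⇒i-j≤0 (ℤP.i<j⇒suc[i]≤j i<j)))
  where
  shift : ∀ i j → ((1ℤ ℤ.+ i) - j) ℤ.+ -1ℤ ≡ i - j
  shift = solve-∀

edgeContrib-at-strict-min : ∀ {n} {φ : Fin n → ℤ} {x} → (∀ y → y ≢ x → φ x < φ y) →
  ∀ {e} → proj₁ e ≢ proj₂ e → edgeContrib φ x e ≤ (if incident x e then -1ℤ else 0ℤ)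
edgeContrib-at-strict-min {φ = φ} {x} φx<φ {e} loopless with edgeAt x e
... | from y rewrite edgeContrib-from φ x y | incident-from x y =
  i<j⇒i-j≤-1 (φx<φ y (loopless ∘ sym))
... | to y rewrite edgeContrib-to φ x y | incident-to x y = i<j⇒i-j≤-1 (φx<φ y loopless)
... | away a≢x b≢x rewrite edgeContrib-away φ x a≢x b≢x | incident-away a≢x b≢x = ℤP.≤-refl

sum+|E|≤|deletion| : ∀ {n} (v : Fin n) (c : Fin n × Fin n → ℤ) (E : EdgeList n) →
  (∀ {e} → e ∈ E → c e ≤ (if incident v e then -1ℤ else 0ℤ)) →
  sumℤ (map c E) ℤ.+ + length E ≤ + length (deleteVertexEdges v E)
sum+|E|≤|deletion| v c []      _   = ℤP.≤-refl
sum+|E|≤|deletion| v c (e ∷ E) c≤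
  with incident v e | c≤ (here refl) | sum+|E|≤|deletion| v c E (c≤ ∘ there)
... | true  | cₑ≤-1 | ih =
  ℤP.≤-trans (ℤP.≤-reflexive (interchange (c e) _ 1ℤ _)) (ℤP.+-mono-≤ (ℤP.+-monoˡ-≤ 1ℤ cₑ≤-1) ih)
... | false | cₑ≤0  | ih =
  ℤP.≤-trans (ℤP.≤-reflexive (interchange (c e) _ 1ℤ _)) (ℤP.+-mono-≤ (ℤP.+-monoˡ-≤ 1ℤ cₑ≤0) ih)

Δ+|E|≤|deletion|-at-strict-min : (G : Graph) {φ : Fin (n G) → ℤ} {v : Fin (n G)} →
  (∀ y → y ≢ v → φ v < φ y) →
  Δ G φ v ℤ.+ + length (edges G) ≤ + length (deleteVertexEdges v (edges G))
Δ+|E|≤|deletion|-at-strict-min G φv<φ = sum+|E|≤|deletion| _ _ (edges G)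
  (λ e∈ → edgeContrib-at-strict-min φv<φ (All.lookup (noLoops G) e∈))

strict-min⇒n≤1+|deletion| : (G : Graph) (v : Fin (n G)) (φ : Fin (n G) → ℤ) →
  (∀ y → y ≢ v → φ v < φ y) → 0ℤ ≤ genus G ℤ.+ Δ G φ v →
  n G ℕ.≤ ℕ.suc (length (deleteVertexEdges v (edges G)))
strict-min⇒n≤1+|deletion| G v φ φv<φ 0≤g+Δ = ℤP.drop‿+≤+ (begin
  + n G                                   ≡⟨ sym (ℤP.+-identityʳ _) ⟩
  + n G ℤ.+ 0ℤ                            ≤⟨ ℤP.+-monoʳ-≤ (+ n G) 0≤g+Δ ⟩
  + n G ℤ.+ (genus G ℤ.+ Δ G φ v)         ≡⟨ regroup (+ n G) (+ length (edges G)) (Δ G φ v) ⟩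
  1ℤ ℤ.+ (Δ G φ v ℤ.+ + length (edges G))
    ≤⟨ ℤP.+-monoʳ-≤ 1ℤ (Δ+|E|≤|deletion|-at-strict-min G φv<φ) ⟩
  1ℤ ℤ.+ + length (deleteVertexEdges v (edges G)) ∎)
  where
  open ℤP.≤-Reasoning
  regroup : ∀ m e δ → m ℤ.+ (((e - m) ℤ.+ 1ℤ) ℤ.+ δ) ≡ 1ℤ ℤ.+ (δ ℤ.+ e)
  regroup = solve-∀

-- Divisors

-- The divisor c·(P); `gP G P` is `point (genus G) P` by definition.
point : ∀ {n} → ℤ → Fin n → Div n
point c P x = if eqᵇ x P then c else 0ℤ

point-at : ∀ {n} (c : ℤ) (P : Fin n) → point c P P ≡ c
point-at c P rewrite eqᵇ-refl P = refl

point-off : ∀ {n} {c : ℤ} {P x : Fin n} → x ≢ P → point c P x ≡ 0ℤ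
point-off x≢P rewrite eqᵇ-≢ x≢P = refl

point-effective : ∀ {n} {c : ℤ} (P : Fin n) → 0ℤ ≤ c → Effective (point c P)
point-effective P 0≤c x with eqᵇ x P
... | true  = 0≤c
... | false = ℤP.≤-refl

sum-tabulate-zero : ∀ {m} (f : Fin m → ℤ) → (∀ x → f x ≡ 0ℤ) → sumℤ (tabulate f) ≡ 0ℤ
sum-tabulate-zero {ℕ.zero}  f f≡0 = refl
sum-tabulate-zero {ℕ.suc m} f f≡0 = cong₂ ℤ._+_ (f≡0 zero) (sum-tabulate-zero (f ∘ suc) (f≡0 ∘ suc))

sum-tabulate-single : ∀ {m} (f : Fin m → ℤ) P → (∀ x → x ≢ P → f x ≡ 0ℤ) → sumℤ (tabulate f) ≡ f P
sum-tabulate-single f zero f≡0 =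
  trans (cong (ℤ._+_ (f zero)) (sum-tabulate-zero (f ∘ suc) (λ x → f≡0 (suc x) λ ())))
        (ℤP.+-identityʳ (f zero))
sum-tabulate-single f (suc P) f≡0 =
  trans (cong₂ ℤ._+_ (f≡0 zero λ ())
                     (sum-tabulate-single (f ∘ suc) P λ x x≢P → f≡0 (suc x) (x≢P ∘ suc-injective)))
        (ℤP.+-identityˡ (f (suc P)))

deg-point : ∀ {n} (c : ℤ) (P : Fin n) → deg (point c P) ≡ c
deg-point {n} c P = begin
  sumℤ (map (point c P) (allFin n)) ≡⟨ cong sumℤ (map-tabulate (λ x → x) (point c P)) ⟩
  sumℤ (tabulate (point c P))       ≡⟨ sum-tabulate-single (point c P) P (λ _ → point-off) ⟩
  point c P P                       ≡⟨ point-at c P ⟩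
  c                                 ∎
  where open ≡-Reasoning

nonempty[D-F]⇒F≤D+Δφ : (G : Graph) (D F : Div (n G)) → LinSysNonempty G (D -D F) →
  ∃[ φ ] (∀ x → F x ≤ D x ℤ.+ Δ G φ x)
nonempty[D-F]⇒F≤D+Δφ G D F (E , E≥0 , φ , E-[D-F]≡Δφ) = φ , λ x → begin
  F x                         ≡⟨ sym (ℤP.+-identityˡ (F x)) ⟩
  0ℤ ℤ.+ F x                  ≤⟨ ℤP.+-monoˡ-≤ (F x) (E≥0 x) ⟩
  E x ℤ.+ F x                 ≡⟨ regroup (E x) (D x) (F x) ⟩
  D x ℤ.+ (E x - (D x - F x)) ≡⟨ cong (ℤ._+_ (D x)) (E-[D-F]≡Δφ x) ⟩
  D x ℤ.+ Δ G φ x             ∎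
  where
  open ℤP.≤-Reasoning
  regroup : ∀ e d f → e ℤ.+ f ≡ d ℤ.+ (e - (d - f))
  regroup = solve-∀

2≰1-m : ∀ m → ¬ (+ 2 ≤ (+ 0 - + m) ℤ.+ 1ℤ)
2≰1-m ℕ.zero            (+≤+ (s≤s ()))
2≰1-m (ℕ.suc ℕ.zero)    (+≤+ ())
2≰1-m (ℕ.suc (ℕ.suc m)) ()

other-vertex : (G : Graph) → + 2 ≤ genus G → (v : Fin (n G)) → ∃[ w ] w ≢ v
other-vertex G 2≤g v with edges G | noLoops G
... | []          | _       = contradiction 2≤g (2≰1-m (n G))
... | (a , b) ∷ _ | a≢b ∷ _ with a ≟ v
...   | no  a≢v  = a , a≢v
...   | yes refl = b , a≢b ∘ sym

lemma4p7 : (G : Graph) → + 2 ≤ genus G → (v : Fin (n G)) →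
    DeletionIsTree G v → ¬ WeierstrassPoint G v
lemma4p7 G 2≤g v (G-v-connected , G-v-acyclic) (_ , k , 1≤k , rank≥k) =
  ℕP.<-irrefl refl (ℕP.≤-trans (acyclic-deletion⇒2+|E|≤n (edges G) w≢v G-v-acyclic)
                               (strict-min⇒n≤1+|deletion| G v φ φv<φ 0≤g+Δφv))
  where
  w = proj₁ (other-vertex G 2≤g v)
  w≢v = proj₂ (other-vertex G 2≤g v)
  kw = point (+ k) w
  potential = nonempty[D-F]⇒F≤D+Δφ G (gP G v) kw
    (rank≥k kw (point-effective w (+≤+ z≤n)) (deg-point (+ k) w))
  φ = proj₁ potential

  kw≤Δφ : ∀ x → x ≢ v → kw x ≤ Δ G φ x
  kw≤Δφ x x≢v = subst (kw x ≤_) (trans (cong (ℤ._+ Δ G φ x) (point-off x≢v)) (ℤP.+-identityˡ _))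
                      (proj₂ potential x)

  0≤g+Δφv : 0ℤ ≤ genus G ℤ.+ Δ G φ v
  0≤g+Δφv = subst₂ _≤_ (point-off (w≢v ∘ sym)) (cong (ℤ._+ Δ G φ v) (point-at (genus G) v))
                   (proj₂ potential v)

  φv<φ : ∀ x → x ≢ v → φ v < φ x
  φv<φ = unique-minimum⇒strict φ v (minimum-only-at-deleted-vertex G v w φ
    (λ x x≢v → G-v-connected x w x≢v w≢v)
    (λ x x≢v → ℤP.≤-trans (point-effective w (+≤+ z≤n) x) (kw≤Δφ x x≢v))
    (ℤP.<-≤-trans (+<+ 1≤k) (subst (_≤ Δ G φ w) (point-at (+ k) w) (kw≤Δφ w w≢v))))
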